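{- Let $G$ be a finite abelian group, let $K\leq G$ be a nontrivial subgroup, and let $\mathscr A=A_1\cdots A_r$ be a setpartition over $G$ such that, for each $i=1,\dots,r$, $|A_i|\geq2$ and $A_i$ is contained in a single coset of $K$. If $r\geq|K|-1$, then there exist a nontrivial subgroup $H\leq K$ and sub-setpartitions $\mathscr A'\mid\mathscr A$ and $\mathscr A''\mid\mathscr A'$ such that $|\mathscr A''|=|H|-1$, $|\mathscr A'|\geq\min\{|\mathscr A|,\ |\mathscr A|-|K/H|+2\}$, $|\sigma(\mathscr A'')|=|H|$, and every set $A_j$ appearing in $\mathscr A'$ is contained in a single coset of $H$.
   Context: A setpartition over $G$ is a finite sequence (multiset) $\mathscr A=A_1\cdots A_r$ of finite nonempty subsets $A_i\subseteq G$; its length is $|\mathscr A|=r$. A sub-setpartition $\mathscr B\mid\mathscr A$ is a sub-multiset of these sets. For a setpartition $\mathscr B=B_1\cdots B_k$, $\sigma(\mathscr B)=B_1+\cdots+B_k$ is the sumset $\{b_1+\cdots+b_k: b_i\in B_i\}$. -}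

module Defs where

open import Level using (0ℓ)
open import Data.Nat using (ℕ; zero; suc)
open import Data.Fin using (Fin)
import Data.Fin as F
open import Data.Fin.Subset using (Subset; _∈_)
open import Data.Vec using (_∷_; [])
open import Data.Bool using (true; false)
open import Data.List using (List; []; _∷_; length; deduplicate; cartesianProductWith)
import Data.List.Membership.Propositional as LM
open import Data.List.Membership.DecPropositional using ()
open import Data.List.Relation.Unary.Unique.Propositional using (Unique)
open import Data.Product using (Σ; ∃; _×_)
open import Relation.Binary.PropositionalEquality using (_≡_; _≢_)
open import Relation.Binary.Definitions using (DecidableEquality)
open import Algebra.Structures using (IsAbelianGroup)
open import Function using (_∘_)

record FiniteAbelianGroup : Set₁ where
  infixl 6 _+_ _-_
  field
    Carrier        : Set
    _+_            : Carrier → Carrier → Carrier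
    0#             : Carrier
    -_             : Carrier → Carrier
    isAbelianGroup : IsAbelianGroup _≡_ _+_ 0# -_
    _≟_            : DecidableEquality Carrier
    elements       : List Carrier
    complete       : ∀ x → x LM.∈ elements

  _-_ : Carrier → Carrier → Carrier
  x - y = x + (- y)

module _ (G : FiniteAbelianGroup) where
  open FiniteAbelianGroup G
  open Data.List.Membership.DecPropositional _≟_ using (_∈?_)

  record Subgroup : Set where
    field
      elems   : List Carrier
      unique  : Unique elems
      has0    : 0# LM.∈ elems
      +-closed : ∀ {x y} → x LM.∈ elems → y LM.∈ elems → (x + y) LM.∈ elems
      neg-closed : ∀ {x} → x LM.∈ elems → (- x) LM.∈ elems

  open Subgroup public

  order : Subgroup → ℕ
  order K = length (elems K)

  _≤G_ : Subgroup → Subgroup → Set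
  H ≤G K = ∀ {x} → x LM.∈ elems H → x LM.∈ elems K

  Nontrivial : Subgroup → Set
  Nontrivial H = Σ Carrier λ x → x LM.∈ elems H × x ≢ 0#

  InSingleCoset : List Carrier → Subgroup → Set
  InSingleCoset X H = ∃ λ g → ∀ {a} → a LM.∈ X → (a - g) LM.∈ elems H

  -- |K/H|: the number of cosets of H in K, counted by keeping one
  -- representative of each class of the relation x - y ∈ H on K.
  index : Subgroup → Subgroup → ℕ
  index K H = length (deduplicate (λ x y → (x - y) ∈? elems H) (elems K))

  sumset : List Carrier → List Carrier → List Carrier
  sumset X Y = deduplicate _≟_ (cartesianProductWith _+_ X Y)

  -- σ of the sub-setpartition of A : Fin r → sets selected by S ⊆ {1..r}:
  -- the sumset of the selected sets (σ of the empty setpartition is {0}).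
  σ : ∀ {r} → (Fin r → List Carrier) → Subset r → List Carrier
  σ {zero}  A []            = 0# ∷ []
  σ {suc r} A (true ∷ S)    = sumset (A F.zero) (σ (A ∘ F.suc) S)
  σ {suc r} A (false ∷ S)   = σ (A ∘ F.suc) S

module Submission where

-- Proof by strong induction on |K|, for the indices M of sets in K-cosets.
-- Greedily select C ⊆ M, keeping |σ(C)| ≥ min (|C| + 1, |K|).  If this reaches
-- |C| = |K| - 1, then |σ(C)| = |K| since σ(C) lies in one K-coset: take H = K.
-- Otherwise it gets stuck: |σ(C)| < |K| and no index of M \ C enlarges σ(C).
-- Then let L be the stabilizer of B = σ(C).  Every A_i with i ∈ M \ C lies in
-- an L-coset, so L ≠ 0; L ≤ K; |B| + |L| ≤ |K|, as B is a union of L-cosets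
-- inside one K-coset; and a Kneser-type count gives |L| (1 + e) ≤ |B|, where
-- e counts the sets of C not inside an L-coset.  So (2 + e) |L| ≤ |K|: L is
-- proper and enough sets lie in L-cosets to recurse on L.  The size estimate
-- for S' is carried in a division-free form (Arithmetic.Bound) and turned into
-- the stated one at the end using |K| ≤ |K/H| |H|.

open import Data.Nat using (ℕ; _≤_)
open import Data.Fin using (Fin)
open import Data.List using (List; length)
open import Data.List.Relation.Unary.Unique.Propositional using (Unique)
open import Data.Product using (Σ; ∃; _×_; _,_; proj₂)
open import Data.Sum using (_⊎_; inj₁; inj₂)
open import Data.Empty using (⊥-elim)
open import Relation.Binary.PropositionalEquality
open import Function using (_∘_; case_of_)
open import Defs

module FiniteSets {A : Set} where
  open import Data.Nat using (suc; _<_; _+_; z≤n; s≤s)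
  open import Data.Nat.Properties using (<⇒≱)
  open import Data.List using ([]; _∷_; _++_; deduplicate)
  open import Data.List.Properties using (length-++)
  open import Data.List.Membership.Propositional using (_∈_; _∉_; find)
  open import Data.List.Membership.Propositional.Properties using (∈-++⁻; ∈-filter⁺)
  open import Data.List.Relation.Binary.Subset.Propositional using (_⊆_)
  open import Data.List.Relation.Binary.Disjoint.Propositional using (Disjoint)
  open import Data.List.Relation.Unary.Any using (here; there)
  open import Data.List.Relation.Unary.All as All using (All; []; _∷_; all?)
  open import Data.List.Relation.Unary.All.Properties using (¬All⇒Any¬)
  open import Data.List.Relation.Unary.AllPairs using ([]; _∷_)
  import Data.List.Relation.Unary.Unique.Propositional.Properties as Unique
  open import Relation.Nullary using (yes; no; ¬?)
  open import Relation.Binary.Definitions using (DecidableEquality; Decidable)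

  remove : ∀ {x : A} {ys} → x ∈ ys → List A
  remove {ys = _ ∷ ys} (here _)  = ys
  remove {ys = y ∷ _}  (there p) = y ∷ remove p

  length-remove : ∀ {x : A} {ys} (p : x ∈ ys) → suc (length (remove p)) ≡ length ys
  length-remove (here _)  = refl
  length-remove (there p) = cong suc (length-remove p)

  ∈-remove : ∀ {x z : A} {ys} (p : x ∈ ys) → z ∈ ys → z ≢ x → z ∈ remove p
  ∈-remove (here refl) (here refl) z≢x = ⊥-elim (z≢x refl)
  ∈-remove (here _)    (there q)   _   = q
  ∈-remove (there _)   (here refl) _   = here refl
  ∈-remove (there p)   (there q)   z≢x = there (∈-remove p q z≢x)

  All≢⇒∉ : ∀ {x : A} {xs} → All (x ≢_) xs → x ∉ xs
  All≢⇒∉ (x≢y ∷ _) (here refl) = x≢y refl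
  All≢⇒∉ (_ ∷ x≢ys) (there p)  = All≢⇒∉ x≢ys p

  ⊆⇒length≤ : ∀ {xs ys : List A} → Unique xs → xs ⊆ ys → length xs ≤ length ys
  ⊆⇒length≤ {[]}     _              _  = z≤n
  ⊆⇒length≤ {x ∷ xs} {ys} (x∉xs ∷ uxs) xs⊆ys =
    subst (suc (length xs) ≤_) (length-remove x∈ys) (s≤s (⊆⇒length≤ uxs xs⊆rest))
    where
    x∈ys : x ∈ ys
    x∈ys = xs⊆ys (here refl)
    xs⊆rest : xs ⊆ remove x∈ys
    xs⊆rest z∈xs = ∈-remove x∈ys (xs⊆ys (there z∈xs)) λ { refl → All≢⇒∉ x∉xs z∈xs }

  disjoint-union≤ : ∀ {xs ys zs : List A} → Unique xs → Unique ys → Disjoint xs ys →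
                    xs ⊆ zs → ys ⊆ zs → length xs + length ys ≤ length zs
  disjoint-union≤ {xs} ux uy disj xs⊆ ys⊆ =
    subst (_≤ _) (length-++ xs) (⊆⇒length≤ (Unique.++⁺ ux uy disj) both)
    where
    both : xs ++ _ ⊆ _
    both p with ∈-++⁻ xs p
    ... | inj₁ q = xs⊆ q
    ... | inj₂ q = ys⊆ q

  module _ (_≟_ : DecidableEquality A) where
    open import Data.List.Membership.DecPropositional _≟_ using (_∈?_)

    ∉⇒length< : ∀ {xs ys : List A} {x} → Unique ys → ys ⊆ xs → x ∈ xs → x ∉ ys →
               length ys < length xs
    ∉⇒length< {ys = ys} {x} uys ys⊆xs x∈xs x∉ys =
      ⊆⇒length≤ (all≢ ∷ uys) λ { (here refl) → x∈xs ; (there q) → ys⊆xs q }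
      where
      all≢ : All (x ≢_) ys
      all≢ = All.tabulate λ { z∈ys refl → x∉ys z∈ys }

    ⊆-length≥⇒⊇ : ∀ {xs ys : List A} → Unique xs → xs ⊆ ys → length ys ≤ length xs → ys ⊆ xs
    ⊆-length≥⇒⊇ {xs} ux xs⊆ys ys≤xs {z} z∈ys with z ∈? xs
    ... | yes z∈xs = z∈xs
    ... | no  z∉xs = ⊥-elim (<⇒≱ (∉⇒length< ux xs⊆ys z∈ys z∉xs) ys≤xs)

    ⊆⊎∉ : ∀ (xs ys : List A) → ys ⊆ xs ⊎ ∃ λ y → y ∈ ys × y ∉ xs
    ⊆⊎∉ xs ys with all? (_∈? xs) ys
    ... | yes all∈ = inj₁ (All.lookup all∈)
    ... | no ¬all∈ = inj₂ (find (¬All⇒Any¬ (_∈? xs) ys ¬all∈))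

  deduplicate-representative : ∀ {R : A → A → Set} (R? : Decidable R) →
    (∀ x → R x x) → (∀ {x y z} → R x y → R y z → R x z) →
    ∀ {z xs} → z ∈ xs → ∃ λ y → y ∈ deduplicate R? xs × R y z
  deduplicate-representative R? refl′ trans′ {xs = x ∷ _} (here refl) = x , here refl , refl′ x
  deduplicate-representative R? refl′ trans′ {xs = x ∷ _} (there z∈xs)
    with deduplicate-representative R? refl′ trans′ z∈xs
  ... | y , y∈ , Ryz with R? x y
  ...   | yes Rxy = x , here refl , trans′ Rxy Ryz
  ...   | no ¬Rxy = y , there (∈-filter⁺ (¬? ∘ R? x) y∈ ¬Rxy) , Ryz

module Selections where
  open import Data.Nat using (zero; suc; _<_; _+_)
  open import Data.Nat.Properties using (<⇒≱; +-suc)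
  open import Data.Fin using (Fin; zero; suc)
  import Data.Fin.Properties as Fin
  open import Data.Fin.Subset using (Subset; ∣_∣; _∈_; _∉_; _⊆_; _∩_; ∁)
  open import Data.Fin.Subset.Properties using (_∈?_; p⊆q⇒∣p∣≤∣q∣; x∈p∩q⁻; x∈p∩q⁺; x∈∁p⇒x∉p)
  open import Data.Vec using (_∷_; []; _[_]≔_; here; there)
  open import Data.Bool using (true; false)
  open import Relation.Nullary using (yes; no; ¬?; _×-dec_)
  open import Relation.Nullary.Decidable using (decidable-stable)

  insert : ∀ {r} → Subset r → Fin r → Subset r
  insert C i = C [ i ]≔ true

  ∈-insert⁻ : ∀ {r} (C : Subset r) i {j} → j ∈ insert C i → j ≡ i ⊎ j ∈ C
  ∈-insert⁻ (_ ∷ C) zero    here      = inj₁ refl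
  ∈-insert⁻ (_ ∷ C) zero    (there p) = inj₂ (there p)
  ∈-insert⁻ (_ ∷ C) (suc i) here      = inj₂ here
  ∈-insert⁻ (_ ∷ C) (suc i) (there p) with ∈-insert⁻ C i p
  ... | inj₁ refl = inj₁ refl
  ... | inj₂ q    = inj₂ (there q)

  insert-⊆ : ∀ {r} {C M : Subset r} {i} → C ⊆ M → i ∈ M → insert C i ⊆ M
  insert-⊆ {C = C} {i = i} C⊆M i∈M j∈ with ∈-insert⁻ C i j∈
  ... | inj₁ refl = i∈M
  ... | inj₂ j∈C  = C⊆M j∈C

  ∣insert∣ : ∀ {r} (C : Subset r) i → i ∉ C → ∣ insert C i ∣ ≡ suc ∣ C ∣
  ∣insert∣ (true  ∷ C) zero    i∉C = ⊥-elim (i∉C here)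
  ∣insert∣ (false ∷ C) zero    i∉C = refl
  ∣insert∣ (true  ∷ C) (suc i) i∉C = cong suc (∣insert∣ C i (i∉C ∘ there))
  ∣insert∣ (false ∷ C) (suc i) i∉C = ∣insert∣ C i (i∉C ∘ there)

  missing : ∀ {r} (C M : Subset r) → C ⊆ M → ∣ C ∣ < ∣ M ∣ → ∃ λ i → i ∈ M × i ∉ C
  missing C M C⊆M ∣C∣<∣M∣ with Fin.any? (λ i → (i ∈? M) ×-dec ¬? (i ∈? C))
  ... | yes found = found
  ... | no ¬found = ⊥-elim (<⇒≱ ∣C∣<∣M∣ (p⊆q⇒∣p∣≤∣q∣ M⊆C))
    where
    M⊆C : M ⊆ C
    M⊆C {i} i∈M = decidable-stable (i ∈? C) λ i∉C → ¬found (i , i∈M , i∉C)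

  ∣∩∣+∣∩∁∣ : ∀ {r} (M P : Subset r) → ∣ M ∣ ≡ ∣ M ∩ P ∣ + ∣ M ∩ ∁ P ∣
  ∣∩∣+∣∩∁∣ []          []          = refl
  ∣∩∣+∣∩∁∣ (true  ∷ M) (true  ∷ P) = cong suc (∣∩∣+∣∩∁∣ M P)
  ∣∩∣+∣∩∁∣ (true  ∷ M) (false ∷ P) = trans (cong suc (∣∩∣+∣∩∁∣ M P)) (sym (+-suc _ _))
  ∣∩∣+∣∩∁∣ (false ∷ M) (_     ∷ P) = ∣∩∣+∣∩∁∣ M P

  ∩∁-mono : ∀ {r} {C M : Subset r} P → C ⊆ M → (∀ {i} → i ∈ M → i ∉ C → i ∈ P) →
            M ∩ ∁ P ⊆ C ∩ ∁ P
  ∩∁-mono {C = C} {M} P C⊆M outside-C⇒P {i} i∈ with x∈p∩q⁻ M (∁ P) i∈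
  ... | i∈M , i∈∁P = x∈p∩q⁺ (decidable-stable (i ∈? C) (x∈∁p⇒x∉p i∈∁P ∘ outside-C⇒P i∈M) , i∈∁P)

module Arithmetic where
  open import Data.Nat using (suc; _<_; _+_; _*_; _∸_; _⊓_; s≤s; >-nonZero)
  open import Data.Nat.Properties

  open ≤-Reasoning

  -- Bound m s h k says  s ≥ min (m , m + 2 - k / h)  without using division:
  -- the size estimate for the selected sub-setpartition, relative to a group
  -- of order k and the final subgroup of order h.
  Bound : ℕ → ℕ → ℕ → ℕ → Set
  Bound m s h k = m ≤ s ⊎ (m + 2) * h ≤ s * h + k

  two+e : ∀ {l b k} e → l * suc e ≤ b → b + l ≤ k → (2 + e) * l ≤ k
  two+e {l} {b} {k} e le₁ le₂ = begin
    (2 + e) * l    ≡⟨ *-comm (2 + e) l ⟩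
    l * (2 + e)    ≡⟨ *-suc l (suc e) ⟩
    l + l * suc e  ≤⟨ +-monoʳ-≤ l le₁ ⟩
    l + b          ≡⟨ +-comm l b ⟩
    b + l          ≤⟨ le₂ ⟩
    k              ∎

  two+e⇒< : ∀ {l k} e → 1 ≤ l → (2 + e) * l ≤ k → l < k
  two+e⇒< {l} {k} e 1≤l le = begin-strict
    l                    <⟨ m<m+n l 1≤l ⟩
    l + l                ≤⟨ +-monoʳ-≤ l (m≤m+n l (e * l)) ⟩
    l + (l + e * l)      ≡⟨⟩
    (2 + e) * l          ≤⟨ le ⟩
    k                    ∎

  two+e⇒≤ : ∀ {l k m m'} e → 1 ≤ l → (2 + e) * l ≤ k → k ∸ 1 ≤ m → m ≤ m' + e → l ≤ m'
  two+e⇒≤ {l} {k} {m} {m'} e 1≤l le k-1≤m m≤ = +-cancelʳ-≤ (suc e) l m' (begin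
    l + suc e            ≡⟨ +-comm l (suc e) ⟩
    suc e + l            ≤⟨ +-monoˡ-≤ l (s≤s (m≤m*n e l {{>-nonZero 1≤l}})) ⟩
    suc (e * l) + l      ≤⟨ +-monoˡ-≤ l (+-monoˡ-≤ (e * l) 1≤l) ⟩
    l + e * l + l        ≡⟨ +-comm (l + e * l) l ⟩
    (2 + e) * l          ≤⟨ le ⟩
    k                    ≤⟨ m≤n+m∸n k 1 ⟩
    suc (k ∸ 1)          ≤⟨ s≤s (≤-trans k-1≤m m≤) ⟩
    suc (m' + e)         ≡⟨ +-suc m' e ⟨
    m' + suc e           ∎)

  bound-step : ∀ {m m' e s h l k} → m ≤ m' + e → h ≤ l → (2 + e) * l ≤ k →
               Bound m' s h l → Bound m s h k
  bound-step {m} {m'} {e} {s} {h} {l} {k} m≤ h≤l le (inj₁ m'≤s) = inj₂ (begin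
    (m + 2) * h          ≤⟨ *-monoˡ-≤ h (+-monoˡ-≤ 2 (≤-trans m≤ (+-monoˡ-≤ e m'≤s))) ⟩
    (s + e + 2) * h      ≡⟨ cong (_* h) (trans (+-assoc s e 2) (cong (s +_) (+-comm e 2))) ⟩
    (s + (2 + e)) * h    ≡⟨ *-distribʳ-+ h s (2 + e) ⟩
    s * h + (2 + e) * h  ≤⟨ +-monoʳ-≤ (s * h) (*-monoʳ-≤ (2 + e) h≤l) ⟩
    s * h + (2 + e) * l  ≤⟨ +-monoʳ-≤ (s * h) le ⟩
    s * h + k            ∎)
  bound-step {m} {m'} {e} {s} {h} {l} {k} m≤ h≤l le (inj₂ le') = inj₂ (begin
    (m + 2) * h              ≤⟨ *-monoˡ-≤ h (+-monoˡ-≤ 2 m≤) ⟩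
    (m' + e + 2) * h         ≡⟨ cong (_* h) (+-assoc m' e 2) ⟩
    (m' + (e + 2)) * h       ≡⟨ cong (λ t → (m' + t) * h) (+-comm e 2) ⟩
    (m' + (2 + e)) * h       ≡⟨ cong (_* h) (+-assoc m' 2 e) ⟨
    (m' + 2 + e) * h         ≡⟨ *-distribʳ-+ h (m' + 2) e ⟩
    (m' + 2) * h + e * h     ≤⟨ +-monoˡ-≤ (e * h) le' ⟩
    s * h + l + e * h        ≤⟨ +-monoʳ-≤ (s * h + l) (*-monoʳ-≤ e h≤l) ⟩
    s * h + l + e * l        ≡⟨ +-assoc (s * h) l (e * l) ⟩
    s * h + (1 + e) * l      ≤⟨ +-monoʳ-≤ (s * h) (*-monoˡ-≤ l (n≤1+n (1 + e))) ⟩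
    s * h + (2 + e) * l      ≤⟨ +-monoʳ-≤ (s * h) le ⟩
    s * h + k                ∎)

  bound⇒min : ∀ {m s h k} i → 1 ≤ h → k ≤ i * h → Bound m s h k → m ⊓ ((m + 2) ∸ i) ≤ s
  bound⇒min i _ _ (inj₁ m≤s) = ≤-trans (m⊓n≤m _ _) m≤s
  bound⇒min {m} {s} {h} {k} i 1≤h k≤ih (inj₂ le) =
    ≤-trans (m⊓n≤n m _) (m≤n+o⇒m∸n≤o (m + 2) i (subst (m + 2 ≤_) (+-comm s i) m+2≤s+i))
    where
    m+2≤s+i : m + 2 ≤ s + i
    m+2≤s+i = *-cancelʳ-≤ (m + 2) (s + i) h {{>-nonZero 1≤h}} (begin
      (m + 2) * h     ≤⟨ le ⟩
      s * h + k       ≤⟨ +-monoʳ-≤ (s * h) k≤ih ⟩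
      s * h + i * h   ≡⟨ *-distribʳ-+ h s i ⟨
      (s + i) * h     ∎)

module GroupTheory (G : FiniteAbelianGroup) where
  open import Level using (0ℓ)
  open import Data.Nat using (_<_; z≤n; s≤s; _*_) renaming (_+_ to _+ℕ_)
  open import Data.Nat.Properties using (≤-reflexive; <⇒≱)
  open import Data.List using ([]; _∷_; map; filter; deduplicate; concatMap)
  open import Data.List.Properties using (length-map; length-++)
  open import Data.List.Membership.Propositional using (_∈_; _∉_)
  open import Data.List.Membership.Propositional.Properties
    using (∈-map⁺; ∈-map⁻; ∈-filter⁺; ∈-filter⁻; ∈-deduplicate⁺; ∈-deduplicate⁻;
           ∈-cartesianProductWith⁺; ∈-cartesianProductWith⁻; ∈-concatMap⁺)
  open import Data.List.Relation.Binary.Subset.Propositional using (_⊆_)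
  open import Data.List.Relation.Unary.Any as Any using (here)
  open import Data.List.Relation.Unary.All as All using (All; all?)
  import Data.List.Relation.Unary.Unique.Propositional.Properties as Unique
  open import Relation.Nullary using (¬_; Dec; yes; no)
  open import Algebra.Bundles using (AbelianGroup)

  open FiniteAbelianGroup G
  open FiniteSets {Carrier}
  open import Data.List.Membership.DecPropositional _≟_ using (_∈?_)
  open import Data.List.Relation.Unary.Unique.DecPropositional.Properties _≟_ using (deduplicate-!)

  abelianGroup : AbelianGroup 0ℓ 0ℓ
  abelianGroup = record { isAbelianGroup = isAbelianGroup }

  open AbelianGroup abelianGroup using (assoc; comm; identityʳ; inverseʳ)
  open import Algebra.Properties.AbelianGroup abelianGroup
    using (∙-cancelˡ; //-rightDividesˡ; //-rightDividesʳ; \\-leftDividesʳ; xyx⁻¹≈y; x∙y⁻¹≈ε⇒x≈y;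
           ⁻¹-anti-homo‿-; ⁻¹-∙-comm)
  open import Algebra.Properties.CommutativeSemigroup (AbelianGroup.commutativeSemigroup abelianGroup)
    using (interchange)
  open ≡-Reasoning

  sub-+ : ∀ x y → (x - y) + y ≡ x
  sub-+ x y = //-rightDividesˡ y x

  +-sub-cancel : ∀ x y → (x + y) - y ≡ x
  +-sub-cancel x y = //-rightDividesʳ y x

  +-sub : ∀ x y → y + (x - y) ≡ x
  +-sub x y = trans (comm y (x - y)) (sub-+ x y)

  sub-chain : ∀ x y z → (x - y) + (y - z) ≡ x - z
  sub-chain x y z = begin
    (x - y) + (y - z)    ≡⟨ assoc x (- y) (y - z) ⟩
    x + (- y + (y - z))  ≡⟨ cong (x +_) (\\-leftDividesʳ y (- z)) ⟩
    x - z                ∎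

  sub-sub : ∀ x z c → (x - c) - (z - c) ≡ x - z
  sub-sub x z c = trans (cong ((x - c) +_) (⁻¹-anti-homo‿- z c)) (sub-chain x c z)

  sub-+-distrib : ∀ a b g h → (a + b) - (g + h) ≡ (a - g) + (b - h)
  sub-+-distrib a b g h = begin
    (a + b) + - (g + h)    ≡⟨ cong ((a + b) +_) (sym (⁻¹-∙-comm g h)) ⟩
    (a + b) + (- g + - h)  ≡⟨ interchange a b (- g) (- h) ⟩
    (a - g) + (b - h)      ∎

  sub-closed : ∀ (H : Subgroup G) {x y} → x ∈ elems H → y ∈ elems H → (x - y) ∈ elems H
  sub-closed H x∈H y∈H = +-closed H x∈H (neg-closed H y∈H)

  self-sub∈ : ∀ (H : Subgroup G) x → (x - x) ∈ elems H
  self-sub∈ H x = subst (_∈ elems H) (sym (inverseʳ x)) (has0 H)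

  order≥1 : ∀ (H : Subgroup G) → 1 ≤ order G H
  order≥1 H with elems H | has0 H
  ... | _ ∷ _ | _ = s≤s z≤n

  infixl 6 _+ᵗ_ _⊕_
  _+ᵗ_ : Carrier → List Carrier → List Carrier
  a +ᵗ X = map (a +_) X

  _⊕_ : List Carrier → List Carrier → List Carrier
  X ⊕ Y = sumset G X Y

  ∈+ᵗ⁺ : ∀ a {x X} → x ∈ X → (a + x) ∈ a +ᵗ X
  ∈+ᵗ⁺ a = ∈-map⁺ (a +_)

  ∈+ᵗ⁻ : ∀ a {z X} → z ∈ a +ᵗ X → ∃ λ x → x ∈ X × z ≡ a + x
  ∈+ᵗ⁻ a = ∈-map⁻ (a +_)

  +ᵗ-unique : ∀ a {X} → Unique X → Unique (a +ᵗ X)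
  +ᵗ-unique a = Unique.map⁺ (∙-cancelˡ a _ _)

  length-+ᵗ : ∀ a X → length (a +ᵗ X) ≡ length X
  length-+ᵗ a = length-map (a +_)

  ∈⊕⁺ : ∀ {a b X Y} → a ∈ X → b ∈ Y → (a + b) ∈ X ⊕ Y
  ∈⊕⁺ a∈X b∈Y = ∈-deduplicate⁺ _≟_ (∈-cartesianProductWith⁺ _+_ a∈X b∈Y)

  ∈⊕⁻ : ∀ {z} X Y → z ∈ X ⊕ Y → ∃ λ a → ∃ λ b → a ∈ X × b ∈ Y × z ≡ a + b
  ∈⊕⁻ X Y z∈ = ∈-cartesianProductWith⁻ _+_ X Y (∈-deduplicate⁻ _≟_ _ z∈)

  ⊕-unique : ∀ X Y → Unique (X ⊕ Y)
  ⊕-unique X Y = deduplicate-! _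

  +ᵗ⊆⊕ : ∀ {a X} Y → a ∈ X → a +ᵗ Y ⊆ X ⊕ Y
  +ᵗ⊆⊕ Y a∈X z∈ with ∈+ᵗ⁻ _ z∈
  ... | y , y∈Y , refl = ∈⊕⁺ a∈X y∈Y

  ≤⊕ : ∀ {a X Y} → a ∈ X → Unique Y → length Y ≤ length (X ⊕ Y)
  ≤⊕ {a} {X} {Y} a∈X uY =
    subst (_≤ _) (length-+ᵗ a Y) (⊆⇒length≤ (+ᵗ-unique a uY) (+ᵗ⊆⊕ Y a∈X))

  coset⊆+ᵗ : ∀ {c X} (H : Subgroup G) → (∀ {x} → x ∈ X → (x - c) ∈ elems H) → X ⊆ c +ᵗ elems H
  coset⊆+ᵗ {c} H in-c+H {x} x∈X = subst (_∈ _) (+-sub x c) (∈+ᵗ⁺ c (in-c+H x∈X))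

  coset-size : ∀ {X} (H : Subgroup G) → Unique X → InSingleCoset G X H → length X ≤ order G H
  coset-size {X} H uX (c , in-c+H) =
    subst (length X ≤_) (length-+ᵗ c (elems H)) (⊆⇒length≤ uX (coset⊆+ᵗ H in-c+H))

  coset-rep : ∀ {X a} (H : Subgroup G) → a ∈ X → InSingleCoset G X H →
              ∀ {a'} → a' ∈ X → (a' - a) ∈ elems H
  coset-rep {a = a} H a∈X (c , in-c+H) {a'} a'∈X =
    subst (_∈ elems H) (sub-sub a' a c) (sub-closed H (in-c+H a'∈X) (in-c+H a∈X))

  inSingleCoset? : ∀ X (H : Subgroup G) → Dec (InSingleCoset G X H)
  inSingleCoset? []      H = yes (0# , λ ())
  inSingleCoset? (x ∷ X) H with all? (λ a → (a - x) ∈? elems H) (x ∷ X)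
  ... | yes all∈ = yes (x , All.lookup all∈)
  ... | no ¬all∈ = no λ inC → ¬all∈ (All.tabulate (coset-rep H (here refl) inC))

  Stabilizes : Carrier → List Carrier → Set
  Stabilizes g X = ∀ {x} → x ∈ X → (x + g) ∈ X

  Periodic : Subgroup G → List Carrier → Set
  Periodic H X = ∀ {h} → h ∈ elems H → Stabilizes h X

  subgroup-periodic : ∀ (H : Subgroup G) → Periodic H (elems H)
  subgroup-periodic H h∈H x∈H = +-closed H x∈H h∈H

  stabilizes? : ∀ X g → Dec (All (λ x → (x + g) ∈ X) X)
  stabilizes? X g = all? (λ x → (x + g) ∈? X) X

  period-onto : ∀ {X g} → Unique X → Stabilizes g X → X ⊆ g +ᵗ X
  period-onto {X} {g} uX g-period =
    ⊆-length≥⇒⊇ _≟_ (+ᵗ-unique g uX) g+X⊆X (≤-reflexive (sym (length-+ᵗ g X)))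
    where
    g+X⊆X : g +ᵗ X ⊆ X
    g+X⊆X z∈ with ∈+ᵗ⁻ g z∈
    ... | x , x∈X , refl = subst (_∈ X) (comm x g) (g-period x∈X)

  stabilizes-neg : ∀ {X g} → Unique X → Stabilizes g X → Stabilizes (- g) X
  stabilizes-neg {X} {g} uX g-period x∈X with ∈+ᵗ⁻ g (period-onto uX g-period x∈X)
  ... | x′ , x′∈X , refl = subst (_∈ X) (sym (xyx⁻¹≈y g x′)) x′∈X

  stabilizerElems : List Carrier → List Carrier
  stabilizerElems X = filter (stabilizes? X) (deduplicate _≟_ elements)

  ∈stab⁺ : ∀ {X g} → Stabilizes g X → g ∈ stabilizerElems X
  ∈stab⁺ {X} {g} g-period =
    ∈-filter⁺ (stabilizes? X) (∈-deduplicate⁺ _≟_ (complete g)) (All.tabulate g-period)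

  ∈stab⁻ : ∀ {X g} → g ∈ stabilizerElems X → Stabilizes g X
  ∈stab⁻ {X} g∈ = All.lookup (proj₂ (∈-filter⁻ (stabilizes? X) {xs = deduplicate _≟_ elements} g∈))

  stabilizer : ∀ X → Unique X → Subgroup G
  stabilizer X uX = record
    { elems      = stabilizerElems X
    ; unique     = Unique.filter⁺ (stabilizes? X) (deduplicate-! elements)
    ; has0       = ∈stab⁺ λ {x} x∈X → subst (_∈ X) (sym (identityʳ x)) x∈X
    ; +-closed   = λ g∈ h∈ → ∈stab⁺ λ {x} x∈X →
                     subst (_∈ X) (assoc x _ _) (∈stab⁻ h∈ (∈stab⁻ g∈ x∈X))
    ; neg-closed = λ g∈ → ∈stab⁺ (stabilizes-neg uX (∈stab⁻ g∈))
    }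

  +ᵗ-periodic : ∀ {X} (H : Subgroup G) a → Periodic H X → Periodic H (a +ᵗ X)
  +ᵗ-periodic {X} H a X-periodic h∈H z∈ with ∈+ᵗ⁻ a z∈
  ... | x , x∈X , refl = subst (_∈ a +ᵗ X) (sym (assoc a x _)) (∈+ᵗ⁺ a (X-periodic h∈H x∈X))

  ⊕-periodic : ∀ {X} (H : Subgroup G) Y → Periodic H X → Periodic H (Y ⊕ X)
  ⊕-periodic {X} H Y X-periodic h∈H z∈ with ∈⊕⁻ Y X z∈
  ... | y , x , y∈Y , x∈X , refl = subst (_∈ Y ⊕ X) (sym (assoc y x _)) (∈⊕⁺ y∈Y (X-periodic h∈H x∈X))

  periodic-gap : ∀ {X Y y} (H : Subgroup G) → Unique X → Periodic H X → X ⊆ Y →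
                 (∀ {h} → h ∈ elems H → (y + h) ∈ Y) → y ∉ X →
                 length X +ℕ order G H ≤ length Y
  periodic-gap {X} {Y} {y} H uX X-periodic X⊆Y y+H⊆Y y∉X =
    subst (λ n → length X +ℕ n ≤ length Y) (length-+ᵗ y (elems H))
      (disjoint-union≤ uX (+ᵗ-unique y (unique H)) disjoint X⊆Y y+H⊆)
    where
    disjoint : ∀ {v} → ¬ (v ∈ X × v ∈ y +ᵗ elems H)
    disjoint (v∈X , v∈y+H) with ∈+ᵗ⁻ y v∈y+H
    ... | h , h∈H , refl = y∉X (subst (_∈ X) (+-sub-cancel y h) (X-periodic (neg-closed H h∈H) v∈X))
    y+H⊆ : y +ᵗ elems H ⊆ Y
    y+H⊆ z∈ with ∈+ᵗ⁻ y z∈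
    ... | h , h∈H , refl = y+H⊆Y h∈H

  growth : ∀ {A X a} (H : Subgroup G) → Unique X → Periodic H X →
           (∀ g → Stabilizes g (A ⊕ X) → g ∈ elems H) → ¬ InSingleCoset G A H → a ∈ A →
           length X +ℕ order G H ≤ length (A ⊕ X)
  growth {A} {X} {a} H uX X-periodic periods⊆H ¬inC a∈A with ⊆⊎∉ _≟_ (a +ᵗ X) (A ⊕ X)
  ... | inj₁ A+X⊆a+X = ⊥-elim (¬inC (a , λ a'∈A → periods⊆H _ (shift a'∈A)))
    where
    -- A + X = a + X, so every difference a' - a of elements of A is a period.
    shift : ∀ {a'} → a' ∈ A → Stabilizes (a' - a) (A ⊕ X)
    shift {a'} a'∈A z∈ with ∈+ᵗ⁻ a (A+X⊆a+X z∈)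
    ... | x , x∈X , refl = subst (_∈ A ⊕ X) eq (∈⊕⁺ a'∈A x∈X)
      where
      eq : a' + x ≡ (a + x) + (a' - a)
      eq = begin
        a' + x               ≡⟨ cong (_+ x) (+-sub a' a) ⟨
        (a + (a' - a)) + x   ≡⟨ assoc a (a' - a) x ⟩
        a + ((a' - a) + x)   ≡⟨ cong (a +_) (comm (a' - a) x) ⟩
        a + (x + (a' - a))   ≡⟨ assoc a x (a' - a) ⟨
        (a + x) + (a' - a)   ∎
  ... | inj₂ (y , y∈A+X , y∉a+X) =
    subst (λ n → n +ℕ order G H ≤ length (A ⊕ X)) (length-+ᵗ a X)
      (periodic-gap H (+ᵗ-unique a uX) (+ᵗ-periodic H a X-periodic) (+ᵗ⊆⊕ X a∈A)
        (λ h∈H → ⊕-periodic H A X-periodic h∈H y∈A+X) y∉a+X)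

  -- |K| ≤ |K/H| · |H|: the translates of H by the chosen coset
  -- representatives cover K.
  length-translates : ∀ (H : Subgroup G) R → length (concatMap (_+ᵗ elems H) R) ≡ length R * order G H
  length-translates H []      = refl
  length-translates H (y ∷ R) =
    trans (length-++ (y +ᵗ elems H)) (cong₂ _+ℕ_ (length-+ᵗ y (elems H)) (length-translates H R))

  index-bound : ∀ (K H : Subgroup G) → order G K ≤ index G K H * order G H
  index-bound K H = subst (order G K ≤_) (length-translates H reps) (⊆⇒length≤ (unique K) cover)
    where
    reps : List Carrier
    reps = deduplicate (λ x y → (x - y) ∈? elems H) (elems K)
    cover : elems K ⊆ concatMap (_+ᵗ elems H) reps
    cover {k} k∈K with deduplicate-representative (λ x y → (x - y) ∈? elems H) (self-sub∈ H)
                         (λ {x} {y} {z} p q → subst (_∈ elems H) (sub-chain x y z) (+-closed H p q)) k∈K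
    ... | y , y∈reps , y-k∈H = ∈-concatMap⁺ (_+ᵗ elems H) (Any.map (λ { refl → k∈y+H }) y∈reps)
      where
      k∈y+H : k ∈ y +ᵗ elems H
      k∈y+H = subst (_∈ y +ᵗ elems H) (+-sub k y)
                (∈+ᵗ⁺ y (subst (_∈ elems H) (⁻¹-anti-homo‿- y k) (neg-closed H y-k∈H)))

  stabilizer≤ : ∀ {B b} (uB : Unique B) (K : Subgroup G) → b ∈ B → InSingleCoset G B K →
                _≤G_ G (stabilizer B uB) K
  stabilizer≤ {b = b} uB K b∈B inC {g} g∈ =
    subst (_∈ elems K) (xyx⁻¹≈y b g) (coset-rep K b∈B inC (∈stab⁻ g∈ b∈B))

  coset-gap : ∀ {B} (H K : Subgroup G) → Unique B → Periodic H B → _≤G_ G H K →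
              InSingleCoset G B K → length B < order G K → length B +ℕ order G H ≤ order G K
  coset-gap {B} H K uB B-periodic H≤K (c , in-c+K) ∣B∣<∣K∣
    with ⊆⊎∉ _≟_ B (c +ᵗ elems K)
  ... | inj₁ c+K⊆B = ⊥-elim (<⇒≱ ∣B∣<∣K∣
          (subst (_≤ length B) (length-+ᵗ c (elems K)) (⊆⇒length≤ (+ᵗ-unique c (unique K)) c+K⊆B)))
  ... | inj₂ (y , y∈c+K , y∉B) =
    subst (length B +ℕ order G H ≤_) (length-+ᵗ c (elems K))
      (periodic-gap H uB B-periodic (coset⊆+ᵗ K in-c+K) y+h∈ y∉B)
    where
    y+h∈ : ∀ {h} → h ∈ elems H → (y + h) ∈ c +ᵗ elems K
    y+h∈ h∈H = +ᵗ-periodic {elems K} K c (subgroup-periodic K) (H≤K h∈H) y∈c+K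

  two-points⇒nontrivial : ∀ {X x y} (H : Subgroup G) → x ∈ X → y ∈ X → x ≢ y →
                          InSingleCoset G X H → Nontrivial G H
  two-points⇒nontrivial {x = x} {y} H x∈X y∈X x≢y inC =
    y - x , coset-rep H x∈X inC y∈X , λ y-x≡0 → x≢y (sym (x∙y⁻¹≈ε⇒x≈y y x y-x≡0))

  ⊕-stabilizer⊆ : ∀ B (uB : Unique B) → B ⊕ elems (stabilizer B uB) ⊆ B
  ⊕-stabilizer⊆ B uB z∈ with ∈⊕⁻ B (stabilizerElems B) z∈
  ... | b , g , b∈B , g∈ , refl = ∈stab⁻ g∈ b∈B

  periods-⊕-stabilizer : ∀ B (uB : Unique B) {g} → Stabilizes g (B ⊕ elems (stabilizer B uB)) →
                         g ∈ elems (stabilizer B uB)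
  periods-⊕-stabilizer B uB {g} g-period = ∈stab⁺ λ {b} b∈B →
    subst (λ x → (x + g) ∈ B) (identityʳ b)
      (⊕-stabilizer⊆ B uB (g-period (∈⊕⁺ b∈B (has0 (stabilizer B uB)))))

module Setpartitions (G : FiniteAbelianGroup) where
  open import Data.Nat using (zero; suc; _*_) renaming (_+_ to _+ℕ_)
  open import Data.Nat.Properties using (≤-trans; +-monoʳ-≤; +-comm; *-suc; *-identityʳ; module ≤-Reasoning)
  import Data.Fin as Fin
  open import Data.Fin.Subset using (Subset; ∣_∣; ⊥; _∩_; ∁) renaming (_∈_ to _∈ₛ_; _∉_ to _∉ₛ_)
  open import Data.Vec using (_∷_; []; here; there)
  open import Data.Bool using (true; false)
  open import Data.List using ([]; _∷_)
  open import Data.List.Membership.Propositional using (_∈_)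
  open import Data.List.Relation.Binary.Subset.Propositional using (_⊆_)
  open import Data.List.Relation.Unary.Any using (here; there)
  open import Data.List.Relation.Unary.All using ([])
  open import Data.List.Relation.Unary.AllPairs using ([]; _∷_)
  open import Relation.Nullary using (¬_; yes; no; does)
  open import Algebra.Bundles using (AbelianGroup)

  open FiniteAbelianGroup G
  open GroupTheory G
  open FiniteSets {Carrier}
  open Selections
  open AbelianGroup abelianGroup using (assoc; comm)
  open import Algebra.Properties.CommutativeSemigroup (AbelianGroup.commutativeSemigroup abelianGroup)
    using (x∙yz≈y∙xz)

  ⊕-assocˡ : ∀ X Y Z → (X ⊕ Y) ⊕ Z ⊆ X ⊕ (Y ⊕ Z)
  ⊕-assocˡ X Y Z w∈ with ∈⊕⁻ (X ⊕ Y) Z w∈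
  ... | v , z , v∈ , z∈Z , refl with ∈⊕⁻ X Y v∈
  ...   | x , y , x∈X , y∈Y , refl = subst (_∈ X ⊕ (Y ⊕ Z)) (sym (assoc x y z)) (∈⊕⁺ x∈X (∈⊕⁺ y∈Y z∈Z))

  ⊕-assocʳ : ∀ X Y Z → X ⊕ (Y ⊕ Z) ⊆ (X ⊕ Y) ⊕ Z
  ⊕-assocʳ X Y Z w∈ with ∈⊕⁻ X (Y ⊕ Z) w∈
  ... | x , v , x∈X , v∈ , refl with ∈⊕⁻ Y Z v∈
  ...   | y , z , y∈Y , z∈Z , refl = subst (_∈ (X ⊕ Y) ⊕ Z) (assoc x y z) (∈⊕⁺ (∈⊕⁺ x∈X y∈Y) z∈Z)

  stabilizes-⊕ : ∀ {g} A X → Stabilizes g X → Stabilizes g (A ⊕ X)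
  stabilizes-⊕ A X g-period z∈ with ∈⊕⁻ A X z∈
  ... | a , x , a∈A , x∈X , refl = subst (_∈ A ⊕ X) (sym (assoc a x _)) (∈⊕⁺ a∈A (g-period x∈X))

  -- If adding A to B does not enlarge B, then A lies in a single coset of
  -- the stabilizer of B:  a + B = A + B forces a' - a to be a period of B.
  no-growth⇒coset : ∀ {A B a} (uB : Unique B) → a ∈ A → length (A ⊕ B) ≤ length B →
                    InSingleCoset G A (stabilizer B uB)
  no-growth⇒coset {A} {B} {a} uB a∈A A+B≤B = a , λ a'∈A → ∈stab⁺ (period a'∈A)
    where
    A+B⊆a+B : A ⊕ B ⊆ a +ᵗ B
    A+B⊆a+B = ⊆-length≥⇒⊇ _≟_ (+ᵗ-unique a uB) (+ᵗ⊆⊕ B a∈A)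
                (subst (length (A ⊕ B) ≤_) (sym (length-+ᵗ a B)) A+B≤B)
    period : ∀ {a'} → a' ∈ A → Stabilizes (a' - a) B
    period {a'} a'∈A {b} b∈B with ∈+ᵗ⁻ a (A+B⊆a+B (∈⊕⁺ a'∈A b∈B))
    ... | b' , b'∈B , a'+b≡a+b' = subst (_∈ B) eq b'∈B
      where
      open ≡-Reasoning
      eq : b' ≡ b + (a' - a)
      eq = begin
        b'                   ≡⟨ +-sub-cancel b' a ⟨
        (b' + a) - a         ≡⟨ cong (_- a) (comm b' a) ⟩
        (a + b') - a         ≡⟨ cong (_- a) a'+b≡a+b' ⟨
        (a' + b) - a         ≡⟨ cong (_- a) (comm a' b) ⟩
        (b + a') - a         ≡⟨ assoc b a' (- a) ⟩
        b + (a' - a)         ∎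

  σ-unique : ∀ {r} (A : Fin r → List Carrier) S → Unique (σ G A S)
  σ-unique {zero}  A []          = [] ∷ []
  σ-unique {suc r} A (true ∷ S)  = ⊕-unique (A Fin.zero) (σ G (A ∘ Fin.suc) S)
  σ-unique {suc r} A (false ∷ S) = σ-unique (A ∘ Fin.suc) S

  σ-⊥ : ∀ {r} (A : Fin r → List Carrier) → σ G A ⊥ ≡ 0# ∷ []
  σ-⊥ {zero}  A = refl
  σ-⊥ {suc r} A = σ-⊥ (A ∘ Fin.suc)

  σ-coset : ∀ {r} (A : Fin r → List Carrier) (K : Subgroup G) S →
            (∀ {i} → i ∈ₛ S → InSingleCoset G (A i) K) → InSingleCoset G (σ G A S) K
  σ-coset {zero} A K [] _ = 0# , λ { (here refl) → self-sub∈ K 0# }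
  σ-coset {suc r} A K (false ∷ S) inC = σ-coset (A ∘ Fin.suc) K S (inC ∘ there)
  σ-coset {suc r} A K (true ∷ S) inC
    with inC here | σ-coset (A ∘ Fin.suc) K S (inC ∘ there)
  ... | c₀ , in-c₀+K | c , in-c+K = c₀ + c , λ z∈ → sum∈ z∈
    where
    sum∈ : ∀ {z} → z ∈ σ G A (true ∷ S) → (z - (c₀ + c)) ∈ elems K
    sum∈ z∈ with ∈⊕⁻ (A Fin.zero) (σ G (A ∘ Fin.suc) S) z∈
    ... | a , y , a∈ , y∈ , refl =
      subst (_∈ elems K) (sym (sub-+-distrib a y c₀ c)) (+-closed K (in-c₀+K a∈) (in-c+K y∈))

  σ-insert : ∀ {r} (A : Fin r → List Carrier) C i → i ∉ₛ C → A i ⊕ σ G A C ⊆ σ G A (insert C i)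
  σ-insert A (true  ∷ C) Fin.zero    i∉C _ = ⊥-elim (i∉C here)
  σ-insert A (false ∷ C) Fin.zero    i∉C z∈ = z∈
  σ-insert A (false ∷ C) (Fin.suc i) i∉C z∈ = σ-insert (A ∘ Fin.suc) C i (i∉C ∘ there) z∈
  σ-insert A (true  ∷ C) (Fin.suc i) i∉C z∈
    with ∈⊕⁻ (A (Fin.suc i)) (A Fin.zero ⊕ σ G (A ∘ Fin.suc) C) z∈
  ... | a , v , a∈ , v∈ , refl with ∈⊕⁻ (A Fin.zero) (σ G (A ∘ Fin.suc) C) v∈
  ...   | a₀ , y , a₀∈ , y∈ , refl =
    subst (_∈ σ G A (insert (true ∷ C) (Fin.suc i))) (x∙yz≈y∙xz a₀ a y)
      (∈⊕⁺ a₀∈ (σ-insert (A ∘ Fin.suc) C i (i∉C ∘ there) (∈⊕⁺ a∈ y∈)))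

  σ-insert-≤ : ∀ {r} (A : Fin r → List Carrier) C i {a} → i ∉ₛ C → a ∈ A i →
               length (σ G A C) ≤ length (σ G A (insert C i))
  σ-insert-≤ A C i i∉C a∈ =
    ≤-trans (≤⊕ {X = A i} a∈ (σ-unique A C)) (⊆⇒length≤ (⊕-unique (A i) (σ G A C)) (σ-insert A C i i∉C))

  compatible : ∀ {r} → (Fin r → List Carrier) → Subgroup G → Subset r
  compatible {zero}  A H = []
  compatible {suc r} A H = does (inSingleCoset? (A Fin.zero) H) ∷ compatible (A ∘ Fin.suc) H

  ∈compatible⁺ : ∀ {r} (A : Fin r → List Carrier) H {i} → InSingleCoset G (A i) H → i ∈ₛ compatible A H
  ∈compatible⁺ A H {Fin.zero} inC with inSingleCoset? (A Fin.zero) H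
  ... | yes _  = here
  ... | no ¬inC = ⊥-elim (¬inC inC)
  ∈compatible⁺ A H {Fin.suc i} inC = there (∈compatible⁺ (A ∘ Fin.suc) H inC)

  ∈compatible⁻ : ∀ {r} (A : Fin r → List Carrier) H {i} → i ∈ₛ compatible A H → InSingleCoset G (A i) H
  ∈compatible⁻ A H {Fin.zero} i∈ with inSingleCoset? (A Fin.zero) H | i∈
  ... | yes inC | _ = inC
  ∈compatible⁻ A H {Fin.suc i} (there i∈) = ∈compatible⁻ (A ∘ Fin.suc) H i∈

  incompatibles : ∀ {r} → (Fin r → List Carrier) → Subgroup G → Subset r → ℕ
  incompatibles A H C = ∣ C ∩ ∁ (compatible A H) ∣

  module _ {A₀ S : List Carrier} (H : Subgroup G) where
    private
      X Y : List Carrier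
      X = S ⊕ elems H
      Y = (A₀ ⊕ S) ⊕ elems H

    A₀⊕X≤Y : length (A₀ ⊕ X) ≤ length Y
    A₀⊕X≤Y = ⊆⇒length≤ (⊕-unique A₀ X) (⊕-assocʳ A₀ S (elems H))

    -- A₀ + X and Y are the same set, so they have the same periods;
    -- every period of X is one of A₀ + X.
    periods-A₀⊕X : (∀ g → Stabilizes g Y → g ∈ elems H) → ∀ g → Stabilizes g (A₀ ⊕ X) → g ∈ elems H
    periods-A₀⊕X periods g g-period =
      periods g λ y∈ → ⊕-assocʳ A₀ S (elems H) (g-period (⊕-assocˡ A₀ S (elems H) y∈))

    periods-tail : (∀ g → Stabilizes g Y → g ∈ elems H) → ∀ g → Stabilizes g X → g ∈ elems H
    periods-tail periods g = periods-A₀⊕X periods g ∘ stabilizes-⊕ A₀ X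

    X≤Y : ∀ {a₀} → a₀ ∈ A₀ → length X ≤ length Y
    X≤Y a₀∈ = ≤-trans (≤⊕ {X = A₀} a₀∈ (⊕-unique S (elems H))) A₀⊕X≤Y

    X+H≤Y : ∀ {a₀} → a₀ ∈ A₀ → (∀ g → Stabilizes g Y → g ∈ elems H) → ¬ InSingleCoset G A₀ H →
            length X +ℕ order G H ≤ length Y
    X+H≤Y a₀∈ periods ¬inC = ≤-trans
      (growth H (⊕-unique S (elems H)) (⊕-periodic H S (subgroup-periodic H))
              (periods-A₀⊕X periods) ¬inC a₀∈)
      A₀⊕X≤Y

  sumset-growth : ∀ {r} (A : Fin r → List Carrier) → (∀ i → ∃ (_∈ A i)) → (H : Subgroup G) → ∀ C →
    (∀ g → Stabilizes g (σ G A C ⊕ elems H) → g ∈ elems H) →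
    order G H * suc (incompatibles A H C) ≤ length (σ G A C ⊕ elems H)
  sumset-growth {zero} A _ H [] _ =
    subst (_≤ length ((0# ∷ []) ⊕ elems H)) (sym (*-identityʳ (order G H)))
      (≤⊕ {X = 0# ∷ []} (here refl) (unique H))
  sumset-growth {suc r} A ne H (false ∷ C) periods =
    sumset-growth (A ∘ Fin.suc) (ne ∘ Fin.suc) H C periods
  sumset-growth {suc r} A ne H (true ∷ C) periods with inSingleCoset? (A Fin.zero) H
  ... | yes _   = ≤-trans IH (X≤Y {A Fin.zero} {σ G (A ∘ Fin.suc) C} H (proj₂ (ne Fin.zero)))
    where
    IH : order G H * suc (incompatibles (A ∘ Fin.suc) H C) ≤ length (σ G (A ∘ Fin.suc) C ⊕ elems H)
    IH = sumset-growth (A ∘ Fin.suc) (ne ∘ Fin.suc) H C (periods-tail {A Fin.zero} H periods)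
  ... | no ¬inC = begin
    order G H * suc (suc e)          ≡⟨ *-suc (order G H) (suc e) ⟩
    order G H +ℕ order G H * suc e   ≤⟨ +-monoʳ-≤ (order G H) IH ⟩
    order G H +ℕ length X            ≡⟨ +-comm (order G H) (length X) ⟩
    length X +ℕ order G H            ≤⟨ X+H≤Y {A Fin.zero} H (proj₂ (ne Fin.zero)) periods ¬inC ⟩
    length (σ G A (true ∷ C) ⊕ elems H) ∎
    where
    open ≤-Reasoning
    e : ℕ
    e = incompatibles (A ∘ Fin.suc) H C
    X : List Carrier
    X = σ G (A ∘ Fin.suc) C ⊕ elems H
    IH : order G H * suc e ≤ length X
    IH = sumset-growth (A ∘ Fin.suc) (ne ∘ Fin.suc) H C (periods-tail {A Fin.zero} H periods)

  σ-nonempty : ∀ {r} (A : Fin r → List Carrier) → (∀ i → ∃ (_∈ A i)) → ∀ S → ∃ (_∈ σ G A S)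
  σ-nonempty {zero}  A _  []          = 0# , here refl
  σ-nonempty {suc r} A ne (false ∷ S) = σ-nonempty (A ∘ Fin.suc) (ne ∘ Fin.suc) S
  σ-nonempty {suc r} A ne (true ∷ S)
    with ne Fin.zero | σ-nonempty (A ∘ Fin.suc) (ne ∘ Fin.suc) S
  ... | a , a∈ | y , y∈ = a + y , ∈⊕⁺ a∈ y∈

module Induction (G : FiniteAbelianGroup) {r : ℕ} (A : Fin r → List (FiniteAbelianGroup.Carrier G))
                 (A-unique : ∀ i → Unique (A i)) (A-large : ∀ i → 2 ≤ length (A i)) where
  open import Data.Nat using (zero; suc; _<_; _∸_; _⊓_; _*_; s≤s; _≤?_; _<?_) renaming (_+_ to _+ℕ_)
  open import Data.Nat.Properties
    using (≤-trans; ≤-refl; ≤-reflexive; ≤-antisym; ≰⇒>; ≮⇒≥; m⊓n≤m; m⊓n≤n; ⊓-monoʳ-≤; n≤1+n; ⊓-idem;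
           +-monoʳ-≤; m+[n∸m]≡n; m∸n≤m; module ≤-Reasoning)
  open import Data.Nat.Induction using (<-rec)
  import Data.Fin.Properties as Fin
  open import Data.Fin.Subset using (Subset; ∣_∣; ⊥; _∩_) renaming (_∈_ to _∈ₛ_; _∉_ to _∉ₛ_; _⊆_ to _⊆ₛ_)
  open import Data.Fin.Subset.Properties using (_∈?_; ∉⊥; ∣⊥∣≡0; x∈p∩q⁻; p∩q⊆p; p⊆q⇒∣p∣≤∣q∣)
  open import Data.List using ([]; _∷_)
  open import Data.List.Membership.Propositional using (_∈_)
  open import Data.List.Relation.Unary.Any using (here; there)
  open import Data.List.Relation.Unary.AllPairs using ([]; _∷_)
  open import Data.List.Relation.Unary.All using ([]; _∷_)
  open import Relation.Nullary using (yes; no; ¬?; _×-dec_)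

  open FiniteAbelianGroup G
  open GroupTheory G
  open Setpartitions G
  open FiniteSets {Carrier}
  open Selections
  open Arithmetic

  two-elements : ∀ i → ∃ λ x → ∃ λ y → x ∈ A i × y ∈ A i × x ≢ y
  two-elements i with A i | A-large i | A-unique i
  ... | x ∷ y ∷ _ | _       | (x≢y ∷ _) ∷ _ = x , y , here refl , there (here refl) , x≢y
  ... | _ ∷ []    | s≤s () | _

  nonempty : ∀ i → ∃ (_∈ A i)
  nonempty i = let x , _ , x∈ , _ = two-elements i in x , x∈

  size : Subset r → ℕ
  size S = length (σ G A S)

  record Result (K : Subgroup G) (M : Subset r) : Set where
    field
      H            : Subgroup G
      H-nontrivial : Nontrivial G H
      H≤K          : _≤G_ G H K
      S' S''       : Subset r
      S''⊆S'       : S'' ⊆ₛ S'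
      S'⊆M         : S' ⊆ₛ M
      ∣S''∣≡       : ∣ S'' ∣ ≡ order G H ∸ 1
      ∣S'∣-bound   : Bound ∣ M ∣ ∣ S' ∣ (order G H) (order G K)
      σS''≡H       : size S'' ≡ order G H
      S'-cosets    : ∀ {j} → j ∈ₛ S' → InSingleCoset G (A j) H

  module _ (K : Subgroup G) (M : Subset r) where

    record Stuck : Set where
      field
        C         : Subset r
        C⊆M       : C ⊆ₛ M
        ∣C∣<∣M∣   : ∣ C ∣ < ∣ M ∣
        σC<K      : size C < order G K
        saturated : ∀ i → i ∈ₛ M → i ∉ₛ C → size (insert C i) ≤ size C

    Greedy : ℕ → Set
    Greedy k = Σ (Subset r) λ C → C ⊆ₛ M × ∣ C ∣ ≡ k × suc k ⊓ order G K ≤ size C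

    -- Extend a greedy selection by an index that makes σ grow; if there is
    -- none, σ is already as large as K (add any index) or the selection is stuck.
    extend : ∀ {k} → suc k ≤ ∣ M ∣ → Greedy k → Greedy (suc k) ⊎ Stuck
    extend {k} k<∣M∣ (C , C⊆M , refl , lower)
      with Fin.any? (λ i → (i ∈? M) ×-dec (¬? (i ∈? C) ×-dec (size C <? size (insert C i))))
    ... | yes (i , i∈M , i∉C , grows) =
      inj₁ (insert C i , insert-⊆ C⊆M i∈M , ∣insert∣ C i i∉C , (begin
        suc (suc k) ⊓ order G K      ≤⟨ ⊓-monoʳ-≤ (suc (suc k)) (n≤1+n (order G K)) ⟩
        suc (suc k ⊓ order G K)      ≤⟨ s≤s lower ⟩
        suc (size C)                 ≤⟨ grows ⟩
        size (insert C i)            ∎))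
      where open ≤-Reasoning
    ... | no ¬grows with order G K ≤? size C
    ...   | yes K≤σC =
      let i , i∈M , i∉C = missing C M C⊆M k<∣M∣ in
      inj₁ (insert C i , insert-⊆ C⊆M i∈M , ∣insert∣ C i i∉C ,
            ≤-trans (m⊓n≤n _ _) (≤-trans K≤σC (σ-insert-≤ A C i i∉C (proj₂ (nonempty i)))))
    ...   | no ¬K≤σC = inj₂ record
      { C = C ; C⊆M = C⊆M ; ∣C∣<∣M∣ = k<∣M∣ ; σC<K = ≰⇒> ¬K≤σC
      ; saturated = λ i i∈M i∉C → ≮⇒≥ λ grows → ¬grows (i , i∈M , i∉C , grows) }

    greedy : ∀ k → k ≤ ∣ M ∣ → Greedy k ⊎ Stuck
    greedy zero    _ = inj₁ (⊥ , (λ i∈⊥ → ⊥-elim (∉⊥ i∈⊥)) , ∣⊥∣≡0 r ,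
                             subst (λ S → 1 ⊓ order G K ≤ length S) (sym (σ-⊥ A)) (m⊓n≤m 1 _))
    greedy (suc k) k<∣M∣ with greedy k (≤-trans (n≤1+n k) k<∣M∣)
    ... | inj₁ selection = extend k<∣M∣ selection
    ... | inj₂ stuck     = inj₂ stuck

  -- If the greedy selection reaches |K| - 1 indices, K itself is the answer:
  -- σ(C) lies in a coset of K and has at least |K| elements.
  full-selection : ∀ {K M} → Nontrivial G K → (∀ {i} → i ∈ₛ M → InSingleCoset G (A i) K) →
             Greedy K M (order G K ∸ 1) → Result K M
  full-selection {K} {M} K≢0 M-cosets (C , C⊆M , ∣C∣≡ , lower) = record
    { H = K ; H-nontrivial = K≢0 ; H≤K = λ x∈ → x∈
    ; S' = M ; S'' = C ; S''⊆S' = C⊆M ; S'⊆M = λ i∈ → i∈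
    ; ∣S''∣≡ = ∣C∣≡ ; ∣S'∣-bound = inj₁ ≤-refl
    ; σS''≡H = ≤-antisym (coset-size K (σ-unique A C) (σ-coset A K C (M-cosets ∘ C⊆M)))
                         (subst (_≤ size C) K⊓K≡K lower)
    ; S'-cosets = M-cosets }
    where
    K⊓K≡K : suc (order G K ∸ 1) ⊓ order G K ≡ order G K
    K⊓K≡K = trans (cong (_⊓ order G K) (m+[n∸m]≡n (order≥1 K))) (⊓-idem (order G K))

  -- A stuck selection C hands the problem down to the stabilizer L of σ(C),
  -- a proper nontrivial subgroup of K, and to the indices ML of M whose sets
  -- lie in cosets of L.
  module Descent {K M} (M-cosets : ∀ {i} → i ∈ₛ M → InSingleCoset G (A i) K)
                 (∣M∣≥ : order G K ∸ 1 ≤ ∣ M ∣) (stuck : Stuck K M) where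
    open Stuck stuck

    B : List Carrier
    B = σ G A C

    B-unique : Unique B
    B-unique = σ-unique A C

    L : Subgroup G
    L = stabilizer B B-unique

    e : ℕ
    e = incompatibles A L C

    ML : Subset r
    ML = M ∩ compatible A L

    B-coset : InSingleCoset G B K
    B-coset = σ-coset A K C (M-cosets ∘ C⊆M)

    L≤K : _≤G_ G L K
    L≤K = stabilizer≤ B-unique K (proj₂ (σ-nonempty A nonempty C)) B-coset

    -- Saturation: every set outside C lies in a coset of L.
    outside-C : ∀ {i} → i ∈ₛ M → i ∉ₛ C → InSingleCoset G (A i) L
    outside-C {i} i∈M i∉C = no-growth⇒coset B-unique (proj₂ (nonempty i))
      (≤-trans (⊆⇒length≤ (⊕-unique (A i) B) (σ-insert A C i i∉C)) (saturated i i∈M i∉C))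

    L-nontrivial : Nontrivial G L
    L-nontrivial =
      let i , i∈M , i∉C = missing C M C⊆M ∣C∣<∣M∣
          x , y , x∈ , y∈ , x≢y = two-elements i
      in two-points⇒nontrivial L x∈ y∈ x≢y (outside-C i∈M i∉C)

    -- |L| (1 + e) ≤ |σ(C)| and |σ(C)| + |L| ≤ |K|, so (2 + e) |L| ≤ |K|.
    key : (2 +ℕ e) * order G L ≤ order G K
    key = two+e e growth-bound gap
      where
      growth-bound : order G L * suc e ≤ size C
      growth-bound = ≤-trans (sumset-growth A nonempty L C (λ _ → periods-⊕-stabilizer B B-unique))
                             (⊆⇒length≤ (⊕-unique B (elems L)) (⊕-stabilizer⊆ B B-unique))
      gap : size C +ℕ order G L ≤ order G K
      gap = coset-gap L K B-unique ∈stab⁻ L≤K B-coset σC<K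

    -- Only the e incompatible sets of C are lost when passing from M to ML.
    ∣M∣≤∣ML∣+e : ∣ M ∣ ≤ ∣ ML ∣ +ℕ e
    ∣M∣≤∣ML∣+e = ≤-trans (≤-reflexive (∣∩∣+∣∩∁∣ M (compatible A L)))
      (+-monoʳ-≤ ∣ ML ∣ (p⊆q⇒∣p∣≤∣q∣ (∩∁-mono (compatible A L) C⊆M
        λ i∈M i∉C → ∈compatible⁺ A L (outside-C i∈M i∉C))))

    ML-cosets : ∀ {i} → i ∈ₛ ML → InSingleCoset G (A i) L
    ML-cosets i∈ = ∈compatible⁻ A L (proj₂ (x∈p∩q⁻ M (compatible A L) i∈))

    L<K : order G L < order G K
    L<K = two+e⇒< e (order≥1 L) key

    ∣ML∣≥ : order G L ∸ 1 ≤ ∣ ML ∣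
    ∣ML∣≥ = ≤-trans (m∸n≤m (order G L) 1) (two+e⇒≤ e (order≥1 L) key ∣M∣≥ ∣M∣≤∣ML∣+e)

    lift : Result L ML → Result K M
    lift res = record
      { H = H ; H-nontrivial = H-nontrivial ; H≤K = L≤K ∘ H≤K
      ; S' = S' ; S'' = S'' ; S''⊆S' = S''⊆S' ; S'⊆M = p∩q⊆p M (compatible A L) ∘ S'⊆M
      ; ∣S''∣≡ = ∣S''∣≡
      ; ∣S'∣-bound = bound-step ∣M∣≤∣ML∣+e (⊆⇒length≤ (unique H) H≤K) key ∣S'∣-bound
      ; σS''≡H = σS''≡H ; S'-cosets = S'-cosets }
      where open Result res

  Claim : ℕ → Set
  Claim n = ∀ K → order G K ≡ n → Nontrivial G K → ∀ M →
            (∀ {i} → i ∈ₛ M → InSingleCoset G (A i) K) → order G K ∸ 1 ≤ ∣ M ∣ → Result K M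

  claim : ∀ n → Claim n
  claim = <-rec Claim λ where
    _ smaller K refl K≢0 M M-cosets ∣M∣≥ → case greedy K M (order G K ∸ 1) ∣M∣≥ of λ where
      (inj₁ selection) → full-selection K≢0 M-cosets selection
      (inj₂ stuck)     → let open Descent M-cosets ∣M∣≥ stuck in
        lift (smaller L<K L refl L-nontrivial ML ML-cosets ∣ML∣≥)

open import Data.Nat using (_∸_; _+_; _⊓_)
open import Data.Fin.Subset using (Subset; _⊆_; ∣_∣; _∈_; ⊤)
open import Data.Fin.Subset.Properties using (∣⊤∣≡n)

lemma3p5 : (G : FiniteAbelianGroup) → (K : Subgroup G) → Nontrivial G K →
    (r : ℕ) → (A : Fin r → List (FiniteAbelianGroup.Carrier G)) →
    (∀ i → Unique (A i)) →
    (∀ i → 2 ≤ length (A i)) →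
    (∀ i → InSingleCoset G (A i) K) →
    order G K ∸ 1 ≤ r →
    Σ (Subgroup G) λ H → Nontrivial G H × _≤G_ G H K ×
      Σ (Subset r) λ S' → Σ (Subset r) λ S'' → S'' ⊆ S' ×
        ∣ S'' ∣ ≡ order G H ∸ 1 ×
        r ⊓ ((r + 2) ∸ index G K H) ≤ ∣ S' ∣ ×
        length (σ G A S'') ≡ order G H ×
        (∀ {j} → j ∈ S' → InSingleCoset G (A j) H)
lemma3p5 G K K≢0 r A A-unique A-large A-cosets ∣K∣-1≤r =
  H , H-nontrivial , H≤K , S' , S'' , S''⊆S' , ∣S''∣≡ ,
  bound⇒min (index G K H) (order≥1 H) (index-bound K H) bound ,
  σS''≡H , S'-cosets
  where
  open GroupTheory G using (order≥1; index-bound)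
  open Induction G A A-unique A-large using (claim; module Result)
  open Arithmetic using (Bound; bound⇒min)
  open Result (claim _ K refl K≢0 ⊤ (λ {i} _ → A-cosets i)
                     (subst (order G K ∸ 1 ≤_) (sym (∣⊤∣≡n r)) ∣K∣-1≤r))
  bound : Bound r ∣ S' ∣ (order G H) (order G K)
  bound = subst (λ m → Bound m ∣ S' ∣ (order G H) (order G K)) (∣⊤∣≡n r) ∣S'∣-bound
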